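{- For all $k\ge0$, $s_{f_{2k+1}/2}=1$ if $k$ is odd and $s_{f_{2k+1}/2}=0$ if $k$ is even; and $s_{f_{2k+1}/2-1}=0$ if $k$ is odd and $s_{f_{2k+1}/2-1}=1$ if $k$ is even.
   Context: Let $\tau$ be the substitution on $\{0,1\}$ with $\tau(1)=101$, $\tau(0)=1$ (extended to words by concatenation), and let $\mathbf{s}=(s_j)_{j\ge 0}=\lim_{j\to\infty}\tau^j(1)$ be its fixed point beginning with $1$. Define $f_{2j}=|\tau^j(1)|$, $f_{2j+1}=|\tau^j(10)|$; equivalently $f_0=1$, $f_1=2$, $f_{2j+2}=f_{2j}+f_{2j+1}$, $f_{2j+3}=f_{2j}+f_{2j+2}$; the $f_{2j+1}$ are even. -}

module Defs where

open import Data.Nat using (ℕ; zero; suc; _+_)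
open import Data.Bool using (Bool; true; false)
open import Data.List using (List; []; _∷_; _++_; concatMap; length)
open import Data.Product using (_×_; _,_; proj₁; proj₂)
open import Function using (_∘_)

τ-letter : ℕ → List ℕ
τ-letter zero = 1 ∷ []
τ-letter (suc _) = 1 ∷ 0 ∷ 1 ∷ []

τ : List ℕ → List ℕ
τ = concatMap τ-letter

τ^ : ℕ → List ℕ → List ℕ
τ^ zero w = w
τ^ (suc n) w = τ (τ^ n w)

-- n-th letter of a word (default 0 if out of range; never used out of range below).
at : List ℕ → ℕ → ℕ
at [] _ = 0
at (x ∷ _) zero = x
at (_ ∷ xs) (suc n) = at xs n

-- The fixed point s = lim τ^j(1).  Since τ^m(1) is a prefix of τ^{m+1}(1)
-- and |τ^m(1)| ≥ m + 1, the j-th letter of s is the j-th letter of τ^j(1).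
s : ℕ → ℕ
s j = at (τ^ j (1 ∷ [])) j

-- The pair (f_{2j}, f_{2j+1}) = (|τ^j(1)|, |τ^j(10)|), via the recurrence
-- f_0 = 1, f_1 = 2, f_{2j+2} = f_{2j} + f_{2j+1}, f_{2j+3} = f_{2j} + f_{2j+2}.
fpair : ℕ → ℕ × ℕ
fpair zero = 1 , 2
fpair (suc j) = let a = proj₁ (fpair j) ; b = proj₂ (fpair j) in
  (a + b) , (a + (a + b))

fEven : ℕ → ℕ
fEven j = proj₁ (fpair j)

fOdd : ℕ → ℕ
fOdd j = proj₂ (fpair j)

-- Write A k = τ^k(1) and B k = τ^k(0), so that A (k+1) = A k B k A k and B (k+1) = A k.
-- The words A k B k and B k A k differ only by a transposition of two adjacent letters,
-- at positions f_{2k+1}/2 − 1 and f_{2k+1}/2: this holds for k = 0 (10 versus 01), and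
-- A (k+1) B (k+1) = A k (B k A k) A k while B (k+1) A (k+1) = A k (A k B k) A k, so the
-- transposition moves right by |A k| = f_{2k} and its two letters swap at every step.
-- Since A k B k is a prefix of A (k+1), hence of s, the letters of s at these two
-- positions alternate with the parity of k.
module Submission where

open import Defs
open import Data.Nat using (ℕ; zero; suc; _+_; _*_; _∸_; _/_; _%_; _<_; _≤_; s≤s; z≤n)
open import Data.Nat.Properties using (+-comm; +-mono-≤; m≤m+n; n≤1+n; ≤-trans)
open import Data.Nat.DivMod using (m*n/n≡m)
open import Data.Nat.Solver using (module +-*-Solver)
open import Data.List using (List; []; _∷_; _++_; length)
open import Data.List.Properties using (concatMap-++; length-++; ++-assoc; ++-identityʳ)
open import Data.Product using (_×_; _,_; proj₁; ∃; ∃₂)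
open import Relation.Binary.PropositionalEquality

τ-++ : ∀ u v → τ (u ++ v) ≡ τ u ++ τ v
τ-++ = concatMap-++ τ-letter

τ^-++ : ∀ n u v → τ^ n (u ++ v) ≡ τ^ n u ++ τ^ n v
τ^-++ zero    u v = refl
τ^-++ (suc n) u v = trans (cong τ (τ^-++ n u v)) (τ-++ (τ^ n u) (τ^ n v))

τ^-suc : ∀ n w → τ^ (suc n) w ≡ τ^ n (τ w)
τ^-suc zero    w = refl
τ^-suc (suc n) w = cong τ (τ^-suc n w)

A : ℕ → List ℕ
A n = τ^ n (1 ∷ [])

B : ℕ → List ℕ
B n = τ^ n (0 ∷ [])

A-suc : ∀ n → A (suc n) ≡ A n ++ B n ++ A n
A-suc n = begin
  A (suc n)                            ≡⟨ τ^-suc n (1 ∷ []) ⟩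
  τ^ n (1 ∷ 0 ∷ 1 ∷ [])                ≡⟨ τ^-++ n (1 ∷ []) (0 ∷ 1 ∷ []) ⟩
  A n ++ τ^ n (0 ∷ 1 ∷ [])             ≡⟨ cong (A n ++_) (τ^-++ n (0 ∷ []) (1 ∷ [])) ⟩
  A n ++ B n ++ A n                    ∎
  where open ≡-Reasoning

B-suc : ∀ n → B (suc n) ≡ A n
B-suc n = τ^-suc n (0 ∷ [])

AB-suc : ∀ n → A (suc n) ++ B (suc n) ≡ A n ++ (B n ++ A n) ++ A n
AB-suc n = begin
  A (suc n) ++ B (suc n)               ≡⟨ cong₂ _++_ (A-suc n) (B-suc n) ⟩
  (A n ++ B n ++ A n) ++ A n           ≡⟨ ++-assoc (A n) (B n ++ A n) (A n) ⟩
  A n ++ (B n ++ A n) ++ A n           ∎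
  where open ≡-Reasoning

BA-suc : ∀ n → B (suc n) ++ A (suc n) ≡ A n ++ (A n ++ B n) ++ A n
BA-suc n = begin
  B (suc n) ++ A (suc n)               ≡⟨ cong₂ _++_ (B-suc n) (A-suc n) ⟩
  A n ++ A n ++ B n ++ A n             ≡⟨ cong (A n ++_) (++-assoc (A n) (B n) (A n)) ⟨
  A n ++ (A n ++ B n) ++ A n           ∎
  where open ≡-Reasoning

A-suc-prefix : ∀ n → A (suc n) ≡ (A n ++ B n) ++ A n
A-suc-prefix n = trans (A-suc n) (sym (++-assoc (A n) (B n) (A n)))

A-prefix : ∀ m n → ∃ λ r → A (m + n) ≡ A n ++ r
A-prefix zero    n = [] , sym (++-identityʳ (A n))
A-prefix (suc m) n with A-prefix m n
... | r , A[m+n]≡ = r ++ B (m + n) ++ A (m + n) , (begin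
  A (suc m + n)                         ≡⟨ A-suc (m + n) ⟩
  A (m + n) ++ B (m + n) ++ A (m + n)   ≡⟨ cong (_++ B (m + n) ++ A (m + n)) A[m+n]≡ ⟩
  (A n ++ r) ++ B (m + n) ++ A (m + n)  ≡⟨ ++-assoc (A n) r _ ⟩
  A n ++ r ++ B (m + n) ++ A (m + n)    ∎)
  where open ≡-Reasoning

pivot : ℕ → ℕ
pivot zero    = 0
pivot (suc k) = fEven k + pivot k

fOdd≡2[1+pivot] : ∀ k → fOdd k ≡ suc (pivot k) * 2
fOdd≡2[1+pivot] zero    = refl
fOdd≡2[1+pivot] (suc k) = begin
  fEven k + (fEven k + fOdd k)           ≡⟨ cong (λ b → fEven k + (fEven k + b)) (fOdd≡2[1+pivot] k) ⟩
  fEven k + (fEven k + suc (pivot k) * 2) ≡⟨ double (fEven k) (pivot k) ⟩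
  suc (fEven k + pivot k) * 2            ∎
  where
  open ≡-Reasoning
  open +-*-Solver
  double : ∀ a p → a + (a + suc p * 2) ≡ suc (a + p) * 2
  double = solve 2 (λ a p → a :+ (a :+ (con 1 :+ p) :* con 2) := (con 1 :+ a :+ p) :* con 2) refl

fOdd/2≡1+pivot : ∀ k → fOdd k / 2 ≡ suc (pivot k)
fOdd/2≡1+pivot k = trans (cong (_/ 2) (fOdd≡2[1+pivot] k)) (m*n/n≡m (suc (pivot k)) 2)

n<fEven : ∀ n → n < fEven n
n<fEven zero    = s≤s z≤n
n<fEven (suc n) = subst (_≤ fEven n + fOdd n) (+-comm (suc n) 1) (+-mono-≤ (n<fEven n) 0<fOdd)
  where
  0<fOdd : 0 < fOdd n
  0<fOdd = subst (0 <_) (sym (fOdd≡2[1+pivot] n)) (s≤s z≤n)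

length-A-AB : ∀ n → length (A n) ≡ fEven n × length (A n ++ B n) ≡ fOdd n
length-A-AB zero    = refl , refl
length-A-AB (suc n) with length-A-AB n
... | |A|≡ , |AB|≡ = |A'|≡ , (begin
  length (A (suc n) ++ B (suc n))       ≡⟨ cong length (cong (A (suc n) ++_) (B-suc n)) ⟩
  length (A (suc n) ++ A n)             ≡⟨ length-++ (A (suc n)) ⟩
  length (A (suc n)) + length (A n)     ≡⟨ cong₂ _+_ |A'|≡ |A|≡ ⟩
  fEven (suc n) + fEven n               ≡⟨ +-comm (fEven (suc n)) (fEven n) ⟩
  fOdd (suc n)                          ∎)
  where
  open ≡-Reasoning
  |A'|≡ : length (A (suc n)) ≡ fEven (suc n)
  |A'|≡ = begin
    length (A (suc n))                  ≡⟨ cong length (A-suc-prefix n) ⟩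
    length ((A n ++ B n) ++ A n)        ≡⟨ length-++ (A n ++ B n) ⟩
    length (A n ++ B n) + length (A n)  ≡⟨ cong₂ _+_ |AB|≡ |A|≡ ⟩
    fOdd n + fEven n                    ≡⟨ +-comm (fOdd n) (fEven n) ⟩
    fEven (suc n)                       ∎

n<length-A : ∀ n → n < length (A n)
n<length-A n = subst (n <_) (sym (proj₁ (length-A-AB n))) (n<fEven n)

at-++ˡ : ∀ (u v : List ℕ) {j} → j < length u → at (u ++ v) j ≡ at u j
at-++ˡ (x ∷ u) v {zero}  _         = refl
at-++ˡ (x ∷ u) v {suc j} (s≤s j<u) = at-++ˡ u v j<u

-- s j is a letter of A j, and A j and A n are both prefixes of A (n + j) = A (j + n).
s≡at-A : ∀ n {j} → j < length (A n) → s j ≡ at (A n) j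
s≡at-A n {j} j<A with A-prefix n j | A-prefix j n
... | r , A[n+j]≡ | r′ , A[j+n]≡ = begin
  at (A j) j                            ≡⟨ at-++ˡ (A j) r (n<length-A j) ⟨
  at (A j ++ r) j                       ≡⟨ cong (λ w → at w j) A[n+j]≡ ⟨
  at (A (n + j)) j                      ≡⟨ cong (λ m → at (A m) j) (+-comm n j) ⟩
  at (A (j + n)) j                      ≡⟨ cong (λ w → at w j) A[j+n]≡ ⟩
  at (A n ++ r′) j                      ≡⟨ at-++ˡ (A n) r′ j<A ⟩
  at (A n) j                            ∎
  where open ≡-Reasoning

s≡at-AB : ∀ n {j} → j < length (A n ++ B n) → s j ≡ at (A n ++ B n) j
s≡at-AB n {j} j<AB = begin
  s j                                   ≡⟨ s≡at-A (suc n) j<A' ⟩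
  at (A (suc n)) j                      ≡⟨ cong (λ w → at w j) (A-suc-prefix n) ⟩
  at ((A n ++ B n) ++ A n) j            ≡⟨ at-++ˡ (A n ++ B n) (A n) j<AB ⟩
  at (A n ++ B n) j                     ∎
  where
  open ≡-Reasoning
  j<A' : j < length (A (suc n))
  j<A' = subst (j <_) (sym (trans (cong length (A-suc-prefix n)) (length-++ (A n ++ B n))))
               (≤-trans j<AB (m≤m+n _ _))

Transposed : ℕ → ℕ → ℕ → List ℕ → List ℕ → Set
Transposed i x y u v = ∃₂ λ P Q → length P ≡ i × u ≡ P ++ x ∷ y ∷ Q × v ≡ P ++ y ∷ x ∷ Q

transposed-sym : ∀ {i x y u v} → Transposed i x y u v → Transposed i y x v u
transposed-sym (P , Q , |P|≡i , u≡ , v≡) = P , Q , |P|≡i , v≡ , u≡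

transposed-infix : ∀ {i x y u v} w z → Transposed i x y u v →
                   Transposed (length w + i) x y (w ++ u ++ z) (w ++ v ++ z)
transposed-infix {x = x} {y} w z (P , Q , |P|≡i , u≡ , v≡) =
  w ++ P , Q ++ z , trans (length-++ w) (cong (length w +_) |P|≡i) , embed x y u≡ , embed y x v≡
  where
  embed : ∀ a b {t} → t ≡ P ++ a ∷ b ∷ Q → w ++ t ++ z ≡ (w ++ P) ++ a ∷ b ∷ Q ++ z
  embed a b refl = begin
    w ++ (P ++ a ∷ b ∷ Q) ++ z          ≡⟨ cong (w ++_) (++-assoc P (a ∷ b ∷ Q) z) ⟩
    w ++ P ++ a ∷ b ∷ Q ++ z            ≡⟨ ++-assoc w P _ ⟨
    (w ++ P) ++ a ∷ b ∷ Q ++ z          ∎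
    where open ≡-Reasoning

transposed-at : ∀ {i x y u v} → Transposed i x y u v →
                suc i < length u × at u i ≡ x × at u (suc i) ≡ y
transposed-at {x = x} {y} (P , Q , refl , refl , _) = middle P
  where
  middle : ∀ P → suc (length P) < length (P ++ x ∷ y ∷ Q)
                 × at (P ++ x ∷ y ∷ Q) (length P) ≡ x × at (P ++ x ∷ y ∷ Q) (suc (length P)) ≡ y
  middle []      = s≤s (s≤s z≤n) , refl , refl
  middle (_ ∷ P) with middle P
  ... | lt , at-x , at-y = s≤s lt , at-x , at-y

[1+n]%2≡1∸n%2 : ∀ n → suc n % 2 ≡ 1 ∸ n % 2
[1+n]%2≡1∸n%2 zero          = refl
[1+n]%2≡1∸n%2 (suc zero)    = refl
[1+n]%2≡1∸n%2 (suc (suc n)) = [1+n]%2≡1∸n%2 n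

1∸[1+n]%2≡n%2 : ∀ n → 1 ∸ suc n % 2 ≡ n % 2
1∸[1+n]%2≡n%2 zero          = refl
1∸[1+n]%2≡n%2 (suc zero)    = refl
1∸[1+n]%2≡n%2 (suc (suc n)) = 1∸[1+n]%2≡n%2 n

AB-transposed-BA : ∀ k → Transposed (pivot k) (1 ∸ k % 2) (k % 2) (A k ++ B k) (B k ++ A k)
AB-transposed-BA zero    = [] , [] , refl , refl , refl
AB-transposed-BA (suc k)
  rewrite AB-suc k | BA-suc k | 1∸[1+n]%2≡n%2 k | [1+n]%2≡1∸n%2 k | sym (proj₁ (length-A-AB k)) =
  transposed-infix (A k) (A k) (transposed-sym (AB-transposed-BA k))

s-at-pivot : ∀ k → s (pivot k) ≡ 1 ∸ k % 2 × s (suc (pivot k)) ≡ k % 2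
s-at-pivot k with transposed-at (AB-transposed-BA k)
... | lt , at-x , at-y = trans (s≡at-AB k (≤-trans (n≤1+n _) lt)) at-x , trans (s≡at-AB k lt) at-y

lemma5 : (k : ℕ) →
    (k % 2 ≡ 1 → s (fOdd k / 2) ≡ 1 × s (fOdd k / 2 ∸ 1) ≡ 0) ×
    (k % 2 ≡ 0 → s (fOdd k / 2) ≡ 0 × s (fOdd k / 2 ∸ 1) ≡ 1)
lemma5 k rewrite fOdd/2≡1+pivot k with s-at-pivot k
... | s[pivot]≡ , s[1+pivot]≡ =
  (λ k-odd  → trans s[1+pivot]≡ k-odd , trans s[pivot]≡ (cong (1 ∸_) k-odd)) ,
  (λ k-even → trans s[1+pivot]≡ k-even , trans s[pivot]≡ (cong (1 ∸_) k-even))
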